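{- For any graph $G$, $TTr(G)\le \min\{Tr(G),Tr(\overline{G})\}$, where $\overline{G}$ is the complement of $G$.
   Context: All graphs are finite and simple. For disjoint vertex sets $A,B$, $A$ dominates $B$ if every vertex of $B$ has a neighbour in $A$. A transitive partition of order $k$ of $G=(V,E)$ is a partition $\{V_1,\dots,V_k\}$ of $V$ into nonempty sets with $V_i$ dominating $V_j$ for all $1\le i<j\le k$; the transitivity $Tr(G)$ is the maximum such $k$. A tournament transitive partition additionally requires that $V_j$ does not dominate $V_i$ for all $i<j$; the tournament transitivity $TTr(G)$ is the maximum order of such a partition. -}

module Defs where

open import Data.Nat using (ℕ; _≤_)
open import Data.Fin using (Fin)
import Data.Fin
open import Data.Product using (Σ; ∃; _×_; _,_)
open import Relation.Nullary using (¬_)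
open import Relation.Binary.PropositionalEquality using (_≡_; _≢_)

record Graph (n : ℕ) : Set₁ where
  field
    Adj   : Fin n → Fin n → Set
    sym   : ∀ {u v} → Adj u v → Adj v u
    irrefl : ∀ {u} → ¬ Adj u u
open Graph public

complement : ∀ {n} → Graph n → Graph n
complement G = record
  { Adj = λ u v → (u ≢ v) × ¬ Adj G u v
  ; sym = λ { (u≢v , ¬a) → (λ e → u≢v (Relation.Binary.PropositionalEquality.sym e))
                           , (λ a → ¬a (Graph.sym G a)) }
  ; irrefl = λ { (u≢u , _) → u≢u Relation.Binary.PropositionalEquality.refl }
  }

-- A partition {V_1,…,V_k} of V into nonempty sets is given by a surjective
-- map f : Fin n → Fin k (V_i = f⁻¹(i)); parts are indexed 0..k-1.
Surjective : ∀ {n k} → (Fin n → Fin k) → Set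
Surjective {n} {k} f = ∀ (i : Fin k) → ∃ λ (v : Fin n) → f v ≡ i

Dominates : ∀ {n k} → Graph n → (Fin n → Fin k) → Fin k → Fin k → Set
Dominates {n} G f i j = ∀ (v : Fin n) → f v ≡ j → ∃ λ (u : Fin n) → (f u ≡ i) × Adj G u v

record TransitivePartition {n} (G : Graph n) (k : ℕ) : Set where
  field
    part     : Fin n → Fin k
    nonempty : Surjective part
    dom      : ∀ (i j : Fin k) → i Data.Fin.< j → Dominates G part i j

record TournamentTransitivePartition {n} (G : Graph n) (k : ℕ) : Set where
  field
    part     : Fin n → Fin k
    nonempty : Surjective part
    dom      : ∀ (i j : Fin k) → i Data.Fin.< j → Dominates G part i j
    notDom   : ∀ (i j : Fin k) → i Data.Fin.< j → ¬ Dominates G part j i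

IsTransitivity : ∀ {n} → Graph n → ℕ → Set
IsTransitivity G t = TransitivePartition G t × (∀ k → TransitivePartition G k → k ≤ t)

IsTournamentTransitivity : ∀ {n} → Graph n → ℕ → Set
IsTournamentTransitivity G t =
  TournamentTransitivePartition G t × (∀ k → TournamentTransitivePartition G k → k ≤ t)

{-# OPTIONS --safe #-}
-- A tournament transitive partition of G is in particular a transitive
-- partition of G. It is also one of the complement: for i < j, since V_j
-- does not dominate V_i, some x ∈ V_i has no G-neighbour in V_j, so x is
-- adjacent in the complement to every vertex of V_j.
-- Adjacency is not assumed decidable, but finding x needs it; as the
-- conclusion k ≤ t̄ is decidable, it suffices to prove it under the double
-- negation of decidability, which holds on the finite vertex set.
module Submission where

open import Defs
open import Data.Nat using (ℕ; _≤_; _⊓_)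
open import Data.Nat.Properties using (⊓-glb; _≤?_)
open import Data.Fin using (Fin; _<_; _≟_)
open import Data.Fin.Properties using (any?; ¬∀⟶∃¬; <⇒≢; sequence)
open import Data.Product using (∃; _×_; _,_)
open import Data.Empty using (⊥-elim)
open import Effect.Monad using (RawMonad)
open import Relation.Binary.Definitions using (Decidable)
open import Relation.Nullary using (¬_)
open import Relation.Nullary.Decidable
  using (_×-dec_; _→-dec_; decidable-stable; ¬¬-excluded-middle)
open import Relation.Nullary.Negation using (¬¬-Monad; ¬¬-map)
open import Relation.Binary.PropositionalEquality
  using (_≡_; _≢_; cong; trans) renaming (sym to ≡-sym)

toTransitivePartition : ∀ {n k} {G : Graph n} →
  TournamentTransitivePartition G k → TransitivePartition G k
toTransitivePartition T = record { part = part ; nonempty = nonempty ; dom = dom }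
  where open TournamentTransitivePartition T

¬¬-decidable-adjacency : ∀ {n} (G : Graph n) → ¬ ¬ Decidable (Adj G)
¬¬-decidable-adjacency G =
  sequence ¬¬-Applicative λ u → sequence ¬¬-Applicative λ v → ¬¬-excluded-middle
  where open RawMonad ¬¬-Monad using () renaming (rawApplicative to ¬¬-Applicative)

module _ {n k} (G : Graph n) (part : Fin n → Fin k) where

  HasNeighbourIn : Fin k → Fin n → Set
  HasNeighbourIn j x = ∃ λ u → part u ≡ j × Adj G u x

  undominated-vertex : Decidable (Adj G) → ∀ {i j} →
    ¬ Dominates G part i j → ∃ λ x → part x ≡ j × ¬ HasNeighbourIn i x
  undominated-vertex Adj? {i} {j} ¬dom
    with ¬∀⟶∃¬ n _ (λ x → (part x ≟ j) →-dec any? λ u → (part u ≟ i) ×-dec Adj? u x) ¬dom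
  ... | x , ¬dom-x =
    x , decidable-stable (part x ≟ j) (λ x∉Vj → ¬dom-x λ x∈Vj → ⊥-elim (x∉Vj x∈Vj))
      , λ neighbour → ¬dom-x λ _ → neighbour

  complement-dominates : ∀ {i j} → i ≢ j →
    (∃ λ x → part x ≡ i × ¬ HasNeighbourIn j x) → Dominates (complement G) part i j
  complement-dominates i≢j (x , x∈Vi , isolated) v v∈Vj =
    x , x∈Vi , (λ x≡v → i≢j (trans (≡-sym x∈Vi) (trans (cong part x≡v) v∈Vj)))
      , λ x~v → isolated (v , v∈Vj , Graph.sym G x~v)

complementTransitivePartition : ∀ {n k} {G : Graph n} → Decidable (Adj G) →
  TournamentTransitivePartition G k → TransitivePartition (complement G) k
complementTransitivePartition {G = G} Adj? T =
  record { part = part ; nonempty = nonempty ; dom = dom′ }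
  where
  open TournamentTransitivePartition T

  dom′ : ∀ i j → i < j → Dominates (complement G) part i j
  dom′ i j i<j =
    complement-dominates G part (<⇒≢ i<j) (undominated-vertex G part Adj? (notDom i j i<j))

proposition1 : ∀ {n} (G : Graph n) (tt t t̄ : ℕ)
    → IsTournamentTransitivity G tt
    → IsTransitivity G t
    → IsTransitivity (complement G) t̄
    → tt ≤ t ⊓ t̄
proposition1 G tt t t̄ (T , _) (_ , t-maximal) (_ , t̄-maximal) =
  ⊓-glb (t-maximal tt (toTransitivePartition T))
        (decidable-stable (tt ≤? t̄)
          (¬¬-map (λ Adj? → t̄-maximal tt (complementTransitivePartition Adj? T))
                  (¬¬-decidable-adjacency G)))
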